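{- Let $P=\langle\mu,\lambda\rangle$ be a finite perfect group with $|\mu|=2$, $|\lambda|=3$. Let $X=P\wr\mathrm{A}_5$, $h_1=(1,1,1,\lambda,\lambda^{ -1})(123)$, $h_2=(\mu,\mu,\mu,1,1)(12)(45)$, $g=(1,\mu,1,1,\mu)(14)(25)$, $H=\langle h_1,h_2\rangle$ and $\Gamma=\mathrm{Cos}(X,H,HgH)$. Then $\Gamma$ has girth $10$.
   Context: $X=P\wr\mathrm{A}_5=P^5{:}\mathrm{A}_5$, where $\mathrm{A}_5=\mathrm{Alt}\{1,\dots,5\}$ (permutations acting on the right) acts on $P^5$ by $(t_1,\dots,t_5)^{\pi^{ -1}}=(t_{1^\pi},\dots,t_{5^\pi})$; elements are written as $(t_1,\dots,t_5)\pi$. The coset graph $\mathrm{Cos}(X,H,HgH)$ has vertex set the right cosets $Hx$ ($x\in X$), with $Hx\sim Hy$ iff $yx^{ -1}\in HgH$. The girth is the length of a shortest cycle. -}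

module Defs where

open import Level using (Level; _⊔_) renaming (suc to lsuc)
open import Data.Nat using (ℕ; zero; suc; _<_; _≤_)
open import Data.Nat.Properties using (_<?_)
open import Data.Fin using (Fin; zero; suc; inject₁; fromℕ; toℕ)
open import Data.Fin.Permutation using (Permutation′; _⟨$⟩ʳ_; _⟨$⟩ˡ_; _∘ₚ_; flip; transpose)
import Data.Fin.Permutation as Perm
open import Data.List using (List; []; _∷_; length; filter; allFin; concatMap; map)
open import Data.Product using (Σ; _×_; _,_; ∃; ∃-syntax)
open import Relation.Binary.PropositionalEquality using (_≡_)
open import Relation.Nullary using (¬_; Dec)
open import Relation.Nullary.Decidable using (_×-dec_)
open import Data.Nat.DivMod using (_%_)
open import Data.Product using (proj₁; proj₂)
open import Data.Empty using (⊥)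
open import Level using (Lift)
open import Algebra.Bundles using (Group)
open import Algebra.Bundles.Raw using (RawGroup)
import Data.Nat as ℕ

module _ {c ℓ} (G : RawGroup c ℓ) where
  open RawGroup G

  data ⟨_⟩ {s} (S : Carrier → Set s) : Carrier → Set (c ⊔ ℓ ⊔ s) where
    gen  : ∀ {x} → S x → ⟨ S ⟩ x
    one  : ⟨ S ⟩ ε
    mul  : ∀ {x y} → ⟨ S ⟩ x → ⟨ S ⟩ y → ⟨ S ⟩ (x ∙ y)
    inv  : ∀ {x} → ⟨ S ⟩ x → ⟨ S ⟩ (x ⁻¹)
    resp : ∀ {x y} → x ≈ y → ⟨ S ⟩ x → ⟨ S ⟩ y

  data Pair (a b : Carrier) : Carrier → Set (c ⊔ ℓ) where
    fst : ∀ {x} → x ≈ a → Pair a b x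
    snd : ∀ {x} → x ≈ b → Pair a b x

  data IsCommutator : Carrier → Set (c ⊔ ℓ) where
    comm : ∀ {x} a b → x ≈ (a ⁻¹ ∙ b ⁻¹ ∙ a ∙ b) → IsCommutator x

module _ {c ℓ} (P : Group c ℓ) where
  open Group P

  Finite : Set (c ⊔ ℓ)
  Finite = Σ ℕ λ n → Σ (Fin n → Carrier) λ f →
             (∀ x → ∃[ i ] (f i ≈ x)) × (∀ i j → f i ≈ f j → i ≡ j)

  Perfect : Set (c ⊔ ℓ)
  Perfect = ∀ x → ⟨ rawGroup ⟩ (IsCommutator rawGroup) x

  GeneratedBy : Carrier → Carrier → Set (c ⊔ ℓ)
  GeneratedBy a b = ∀ x → ⟨ rawGroup ⟩ (Pair rawGroup a b) x

  HasOrder2 : Carrier → Set ℓ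
  HasOrder2 a = (¬ (a ≈ ε)) × (a ∙ a ≈ ε)

  HasOrder3 : Carrier → Set ℓ
  HasOrder3 a = (¬ (a ≈ ε)) × (a ∙ a ∙ a ≈ ε)

-- Permutations of {1,…,5} (represented as Fin 5, so point k is index k-1),
-- acting on the right: i^π = π ⟨$⟩ʳ i, and i^(πσ) = (i^π)^σ = (π ∘ₚ σ) ⟨$⟩ʳ i.

Sym5 : Set
Sym5 = Permutation′ 5

inversions : Sym5 → ℕ
inversions π = length (filter decInv
                 (concatMap (λ i → map (λ j → (i , j)) (allFin 5)) (allFin 5)))
  where
  decInv : (p : Fin 5 × Fin 5) → Dec ((toℕ (proj₁ p) ℕ.< toℕ (proj₂ p)) ×
                                      (toℕ (π ⟨$⟩ʳ proj₂ p) ℕ.< toℕ (π ⟨$⟩ʳ proj₁ p)))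
  decInv (i , j) = (toℕ i <? toℕ j) ×-dec (toℕ (π ⟨$⟩ʳ j) <? toℕ (π ⟨$⟩ʳ i))

IsEven : Sym5 → Set
IsEven π = inversions π % 2 ≡ 0

-- The wreath product P ≀ S₅ = P⁵ : S₅, elements (t₁,…,t₅)π, with
-- (t)π · (s)σ = (t₁ s_{1^π}, …, t₅ s_{5^π}) πσ,
-- which is the semidirect product for the action
-- (t₁,…,t₅)^{π⁻¹} = (t_{1^π},…,t_{5^π}).
-- X = P ≀ A₅ is the subgroup of elements whose top component is even.

module Wreath {c ℓ} (P : Group c ℓ) where
  open Group P renaming (Carrier to C; _≈_ to _≈ᴾ_; _∙_ to _·_; ε to e; _⁻¹ to inv′)

  record Elt : Set c where
    constructor _⋊_
    field
      base : Fin 5 → C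
      top  : Sym5
  open Elt public

  _≈W_ : Elt → Elt → Set ℓ
  x ≈W y = (∀ i → base x i ≈ᴾ base y i) × (∀ i → top x ⟨$⟩ʳ i ≡ top y ⟨$⟩ʳ i)

  _∙W_ : Elt → Elt → Elt
  (t ⋊ π) ∙W (s ⋊ σ) = (λ i → t i · s (π ⟨$⟩ʳ i)) ⋊ (π ∘ₚ σ)

  εW : Elt
  εW = (λ _ → e) ⋊ Perm.id

  _⁻¹W : Elt → Elt
  (t ⋊ π) ⁻¹W = (λ j → inv′ (t (π ⟨$⟩ˡ j))) ⋊ flip π

  PwrS5 : RawGroup c ℓ
  PwrS5 = record { Carrier = Elt ; _≈_ = _≈W_ ; _∙_ = _∙W_ ; ε = εW ; _⁻¹ = _⁻¹W }

  InX : Elt → Set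
  InX x = IsEven (top x)

  tup : C → C → C → C → C → Fin 5 → C
  tup a b c d f zero = a
  tup a b c d f (suc zero) = b
  tup a b c d f (suc (suc zero)) = c
  tup a b c d f (suc (suc (suc zero))) = d
  tup a b c d f (suc (suc (suc (suc zero)))) = f

  p1 p2 p3 p4 p5 : Fin 5
  p1 = zero
  p2 = suc zero
  p3 = suc (suc zero)
  p4 = suc (suc (suc zero))
  p5 = suc (suc (suc (suc zero)))

  -- (123) = (12)(13) (right action), (12)(45), (14)(25)
  c123 : Sym5
  c123 = transpose p1 p2 ∘ₚ transpose p1 p3

  t12t45 : Sym5
  t12t45 = transpose p1 p2 ∘ₚ transpose p4 p5

  t14t25 : Sym5
  t14t25 = transpose p1 p4 ∘ₚ transpose p2 p5

  module Setup (μ λ' : C) where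
    h₁ h₂ g : Elt
    h₁ = tup e e e λ' (inv′ λ') ⋊ c123
    h₂ = tup μ μ μ e e ⋊ t12t45
    g  = tup e μ e e μ ⋊ t14t25

    InH : Elt → Set (c ⊔ ℓ)
    InH = ⟨ PwrS5 ⟩ (Pair PwrS5 h₁ h₂)

    InHgH : Elt → Set (c ⊔ ℓ)
    InHgH x = ∃[ a ] ∃[ b ] (InH a × InH b × (x ≈W ((a ∙W g) ∙W b)))

    -- Coset graph Cos(X,H,HgH): vertices are the right cosets Hx (x ∈ X),
    -- represented by x; Hx = Hy iff x y⁻¹ ∈ H; Hx ∼ Hy iff y x⁻¹ ∈ HgH.
    SameCoset : Elt → Elt → Set (c ⊔ ℓ)
    SameCoset x y = InH (x ∙W (y ⁻¹W))

    Adj : Elt → Elt → Set (c ⊔ ℓ)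
    Adj x y = InHgH (y ∙W (x ⁻¹W))

    -- a cycle of length suc m: vertices v 0, …, v m (pairwise distinct
    -- cosets), with v i ∼ v (i+1) and v m ∼ v 0
    IsCycle : (m : ℕ) → (Fin (suc m) → Elt) → Set (c ⊔ ℓ)
    IsCycle m v = (∀ i → InX (v i))
                × (∀ i j → SameCoset (v i) (v j) → i ≡ j)
                × (∀ (i : Fin m) → Adj (v (inject₁ i)) (v (suc i)))
                × Adj (v (fromℕ m)) (v zero)

    -- Γ has girth 10: there is a cycle of length 10 and no cycle of
    -- length n with 3 ≤ n < 10 (a cycle has length ≥ 3).
    HasGirth : ℕ → Set (c ⊔ ℓ)
    HasGirth (suc m) = (∃[ v ] IsCycle m v)
                     × (∀ k → 2 ≤ k → k < m → ∀ v → ¬ IsCycle k v)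
    HasGirth zero = Lift (c ⊔ ℓ) ⊥

module Submission where

-- The argument runs on codes of elements of P ≀ S₅: reduced words in the free product
-- ⟨μ, λ | μ², λ³⟩ for the coordinates, and the images of the points under the permutation.
-- Two coded elements certainly differ if their permutations do, or if some quotient of
-- coordinates is conjugate to μ, ⁅μ,λ⁆⁻¹ or (λ⁻¹⁅μ,λ⁆λ)⁅μ,λ⁆⁻¹. These are nontrivial in P
-- because P is perfect: every normal subgroup containing ⁅μ,λ⁆ is all of P, so ⁅μ,λ⁆ = 1
-- would make P trivial, and λ centralising ⁅μ,λ⁆ would make the cyclic group ⟨⁅μ,λ⁆⟩ normal,
-- hence P abelian. The group H = ⟨h₁, h₂⟩ has six elements, and (h₁² g h₁ g)⁵ = 1 gives a
-- cycle of length 10. A shorter cycle v₀, …, v_k is followed vertex by vertex, keeping a code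
-- of some y with vᵢ ∈ H y v₀; a finite search shows that every such walk of length at most 8
-- either revisits a coset or cannot return to H v₀.

open import Algebra.Bundles using (Group)
import Algebra.Properties.Monoid.Mult
open import Data.Bool using (Bool; true; false; not; T; _∧_; _∨_)
open import Data.Bool.ListAction using (all; any)
open import Data.Bool.Properties using (T-∧; T-∨; T-≡) renaming (_≟_ to _≟ᵇ_)
open import Data.Empty using (⊥-elim)
open import Data.Fin using (Fin; zero; suc; toℕ; inject₁; fromℕ; fromℕ<; #_)
open import Data.Fin.Permutation using (Permutation′; _⟨$⟩ʳ_; _⟨$⟩ˡ_)
import Data.Fin.Permutation as Perm
open import Data.Fin.Properties using (all?; any?; toℕ-inject₁; toℕ-fromℕ; toℕ-fromℕ<; toℕ-injective)
  renaming (_≟_ to _≟ᶠ_)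
open import Data.List using (List; []; _∷_; _++_; [_]; map; allFin; inits; deduplicate)
open import Data.List.Extrema.Nat using (argmin)
open import Data.List.Membership.Propositional using (_∈_)
open import Data.List.Membership.Propositional.Properties using (∈-map⁺; ∈-deduplicate⁺; ∈-allFin)
import Data.List.Properties as List
open import Data.List.Relation.Unary.All as All using ()
open import Data.List.Relation.Unary.All.Properties using (all⁺)
open import Data.List.Relation.Unary.Any as Any using (here; there; satisfied)
open import Data.List.Relation.Unary.Any.Properties using (any⁻)
open import Data.Nat using (ℕ; zero; suc; _+_; _*_; _≤_; _<_; _<ᵇ_; _%_; s≤s; z≤n)
open import Data.Nat.Properties
  using (+-comm; *-comm; *-suc; +-suc; +-identityʳ; _≤?_; ≤-refl; ≤-trans; ≤-pred; <⇒≤; <-irrefl; ≤-<-trans;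
         n<1+n; m<n⇒m<1+n; m≤n⇒m<n∨m≡n; <ᵇ⇒<; ≤⇒≯)
  renaming (_≟_ to _≟ⁿ_)
open import Data.Product using (_×_; _,_; proj₁; proj₂; ∃-syntax; uncurry; map₂)
open import Data.Sum as Sum using (_⊎_; inj₁; inj₂; [_,_]′; fromInj₁)
open import Data.Vec using (Vec; []; _∷_; lookup; tabulate; foldl′)
open import Data.Vec.Properties as Vec using (lookup∘tabulate)
open import Data.Vec.Relation.Binary.Pointwise.Inductive as Pointwise using (Pointwise; []; _∷_)
open import Function using (_∘_)
open import Function.Bundles using (Equivalence)
open import Level using (_⊔_)
open import Relation.Binary.Definitions using (DecidableEquality)
open import Relation.Binary.PropositionalEquality as ≡ using (_≡_; _≢_)
open import Relation.Nullary using (¬_; Dec; does; yes; no)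
open import Relation.Nullary.Decidable using (map′; ¬?; _⊎-dec_; _×-dec_; T?; toWitness; ⌊_⌋)
open import Relation.Unary using (Decidable)
open import Defs

module FreeGroupSolver {c ℓ} (G : Group c ℓ) where
  open Group G
  open import Algebra.Properties.Group G
  open import Relation.Binary.Reasoning.Setoid setoid

  infixl 7 _⊙_
  data Expr (n : ℕ) : Set where
    var  : Fin n → Expr n
    unit : Expr n
    _⊙_  : Expr n → Expr n → Expr n
    _⁻   : Expr n → Expr n

  ⟦_⟧ : ∀ {n} → Expr n → Vec Carrier n → Carrier
  ⟦ var i ⟧ ρ = lookup ρ i
  ⟦ unit ⟧  ρ = ε
  ⟦ x ⊙ y ⟧ ρ = ⟦ x ⟧ ρ ∙ ⟦ y ⟧ ρ
  ⟦ x ⁻ ⟧   ρ = ⟦ x ⟧ ρ ⁻¹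

  x₀ : ∀ {n} → Expr (1 + n)
  x₀ = var zero
  x₁ : ∀ {n} → Expr (2 + n)
  x₁ = var (suc zero)
  x₂ : ∀ {n} → Expr (3 + n)
  x₂ = var (suc (suc zero))
  x₃ : ∀ {n} → Expr (4 + n)
  x₃ = var (suc (suc (suc zero)))
  x₄ : ∀ {n} → Expr (5 + n)
  x₄ = var (suc (suc (suc (suc zero))))

  private
    -- (i , true) is the variable i, (i , false) its inverse.
    Literal : ℕ → Set
    Literal n = Fin n × Bool

    module _ {n : ℕ} where

      invertLiteral : Literal n → Literal n
      invertLiteral (i , b) = i , not b

      invertNF : List (Literal n) → List (Literal n)
      invertNF []      = []
      invertNF (a ∷ w) = invertNF w ++ [ invertLiteral a ]

      flatten : Expr n → List (Literal n)
      flatten (var i) = [ i , true ]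
      flatten unit    = []
      flatten (x ⊙ y) = flatten x ++ flatten y
      flatten (x ⁻)   = invertNF (flatten x)

      cancels : Literal n → Literal n → Bool
      cancels (i , b) (j , b′) = does (i ≟ᶠ j) ∧ not (does (b ≟ᵇ b′))

      consCancelling : Literal n → List (Literal n) → List (Literal n)
      consCancelling a []      = [ a ]
      consCancelling a (b ∷ w) with cancels a b
      ... | true  = w
      ... | false = a ∷ b ∷ w

      cancelAll : List (Literal n) → List (Literal n)
      cancelAll []      = []
      cancelAll (a ∷ w) = consCancelling a (cancelAll w)

      normalise : Expr n → List (Literal n)
      normalise e = cancelAll (flatten e)

      ⟦_⟧ˡ : Literal n → Vec Carrier n → Carrier
      ⟦ i , true  ⟧ˡ ρ = lookup ρ i
      ⟦ i , false ⟧ˡ ρ = lookup ρ i ⁻¹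

      ⟦_⟧ⁿ : List (Literal n) → Vec Carrier n → Carrier
      ⟦ [] ⟧ⁿ    ρ = ε
      ⟦ a ∷ w ⟧ⁿ ρ = ⟦ a ⟧ˡ ρ ∙ ⟦ w ⟧ⁿ ρ

      module _ (ρ : Vec Carrier n) where

        ⟦⟧ⁿ-++ : ∀ u v → ⟦ u ++ v ⟧ⁿ ρ ≈ ⟦ u ⟧ⁿ ρ ∙ ⟦ v ⟧ⁿ ρ
        ⟦⟧ⁿ-++ []      v = sym (identityˡ _)
        ⟦⟧ⁿ-++ (a ∷ u) v = trans (∙-congˡ (⟦⟧ⁿ-++ u v)) (sym (assoc _ _ _))

        invertLiteral-sound : ∀ a → ⟦ invertLiteral a ⟧ˡ ρ ≈ ⟦ a ⟧ˡ ρ ⁻¹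
        invertLiteral-sound (i , true)  = refl
        invertLiteral-sound (i , false) = sym (⁻¹-involutive _)

        invertNF-sound : ∀ w → ⟦ invertNF w ⟧ⁿ ρ ≈ ⟦ w ⟧ⁿ ρ ⁻¹
        invertNF-sound []      = sym ε⁻¹≈ε
        invertNF-sound (a ∷ w) = begin
          ⟦ invertNF w ++ [ invertLiteral a ] ⟧ⁿ ρ          ≈⟨ ⟦⟧ⁿ-++ (invertNF w) _ ⟩
          ⟦ invertNF w ⟧ⁿ ρ ∙ (⟦ invertLiteral a ⟧ˡ ρ ∙ ε)
            ≈⟨ ∙-cong (invertNF-sound w) (trans (identityʳ _) (invertLiteral-sound a)) ⟩
          ⟦ w ⟧ⁿ ρ ⁻¹ ∙ ⟦ a ⟧ˡ ρ ⁻¹                         ≈⟨ ⁻¹-anti-homo-∙ _ _ ⟨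
          (⟦ a ⟧ˡ ρ ∙ ⟦ w ⟧ⁿ ρ) ⁻¹                           ∎

        flatten-sound : ∀ e → ⟦ flatten e ⟧ⁿ ρ ≈ ⟦ e ⟧ ρ
        flatten-sound (var i) = identityʳ _
        flatten-sound unit    = refl
        flatten-sound (x ⊙ y) = trans (⟦⟧ⁿ-++ (flatten x) (flatten y)) (∙-cong (flatten-sound x) (flatten-sound y))
        flatten-sound (x ⁻)   = trans (invertNF-sound (flatten x)) (⁻¹-cong (flatten-sound x))

        cancels-sound : ∀ a b → cancels a b ≡ true → ⟦ a ⟧ˡ ρ ∙ ⟦ b ⟧ˡ ρ ≈ ε
        cancels-sound (i , b) (j , b′) eq with i ≟ᶠ j
        cancels-sound (i , true)  (.i , false) eq | yes ≡.refl = inverseʳ _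
        cancels-sound (i , false) (.i , true)  eq | yes ≡.refl = inverseˡ _
        cancels-sound (i , true)  (.i , true)  () | yes ≡.refl
        cancels-sound (i , false) (.i , false) () | yes ≡.refl
        cancels-sound (i , b)     (j , b′)     () | no _

        consCancelling-sound : ∀ a w → ⟦ consCancelling a w ⟧ⁿ ρ ≈ ⟦ a ⟧ˡ ρ ∙ ⟦ w ⟧ⁿ ρ
        consCancelling-sound a []      = refl
        consCancelling-sound a (b ∷ w) with cancels a b in eq
        ... | false = refl
        ... | true  = begin
          ⟦ w ⟧ⁿ ρ                          ≈⟨ identityˡ _ ⟨
          ε ∙ ⟦ w ⟧ⁿ ρ                      ≈⟨ ∙-congʳ (cancels-sound a b eq) ⟨
          (⟦ a ⟧ˡ ρ ∙ ⟦ b ⟧ˡ ρ) ∙ ⟦ w ⟧ⁿ ρ  ≈⟨ assoc _ _ _ ⟩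
          ⟦ a ⟧ˡ ρ ∙ (⟦ b ⟧ˡ ρ ∙ ⟦ w ⟧ⁿ ρ)  ∎

        cancelAll-sound : ∀ w → ⟦ cancelAll w ⟧ⁿ ρ ≈ ⟦ w ⟧ⁿ ρ
        cancelAll-sound []      = refl
        cancelAll-sound (a ∷ w) = trans (consCancelling-sound a (cancelAll w)) (∙-congˡ (cancelAll-sound w))

        normalise-sound : ∀ e → ⟦ normalise e ⟧ⁿ ρ ≈ ⟦ e ⟧ ρ
        normalise-sound e = trans (cancelAll-sound (flatten e)) (flatten-sound e)

  solve : ∀ {n} (x y : Expr n) → normalise x ≡ normalise y → (ρ : Vec Carrier n) → ⟦ x ⟧ ρ ≈ ⟦ y ⟧ ρ
  solve x y eq ρ = begin
    ⟦ x ⟧ ρ             ≈⟨ normalise-sound ρ x ⟨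
    ⟦ normalise x ⟧ⁿ ρ  ≡⟨ ≡.cong (λ w → ⟦ w ⟧ⁿ ρ) eq ⟩
    ⟦ normalise y ⟧ⁿ ρ  ≈⟨ normalise-sound ρ y ⟩
    ⟦ y ⟧ ρ             ∎

module PerfectTwoGenerated {c ℓ} (G : Group c ℓ) (a b : Group.Carrier G)
  (perfect : Perfect G) (generated : GeneratedBy G a b) where

  open Group G
  open import Algebra.Properties.Group G using (⁻¹-involutive; inverseʳ-unique)
  open FreeGroupSolver G
  open import Relation.Binary.Reasoning.Setoid setoid
  private
    module Pow = Algebra.Properties.Monoid.Mult monoid

  ⁅_,_⁆ : Carrier → Carrier → Carrier
  ⁅ x , y ⁆ = x ⁻¹ ∙ y ⁻¹ ∙ x ∙ y

  ⁅,⁆-cong : ∀ {x x′ y y′} → x ≈ x′ → y ≈ y′ → ⁅ x , y ⁆ ≈ ⁅ x′ , y′ ⁆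
  ⁅,⁆-cong x≈x′ y≈y′ = ∙-cong (∙-cong (∙-cong (⁻¹-cong x≈x′) (⁻¹-cong y≈y′)) x≈x′) y≈y′

  ⁅x,x⁆≈ε : ∀ x → ⁅ x , x ⁆ ≈ ε
  ⁅x,x⁆≈ε x = solve (x₀ ⁻ ⊙ x₀ ⁻ ⊙ x₀ ⊙ x₀) unit ≡.refl (x ∷ [])

  ⁅,⁆-swap : ∀ x y → ⁅ x , y ⁆ ≈ ⁅ y , x ⁆ ⁻¹
  ⁅,⁆-swap x y = solve (x₀ ⁻ ⊙ x₁ ⁻ ⊙ x₀ ⊙ x₁) ((x₁ ⁻ ⊙ x₀ ⁻ ⊙ x₁ ⊙ x₀) ⁻) ≡.refl (x ∷ y ∷ [])

  commuting⇒⁅,⁆≈ε : ∀ {x y} → x ∙ y ≈ y ∙ x → ⁅ x , y ⁆ ≈ ε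
  commuting⇒⁅,⁆≈ε {x} {y} xy≈yx = begin
    ⁅ x , y ⁆                ≈⟨ solve (x₀ ⁻ ⊙ x₁ ⁻ ⊙ x₀ ⊙ x₁) ((x₀ ⁻ ⊙ x₁ ⁻) ⊙ (x₀ ⊙ x₁)) ≡.refl (x ∷ y ∷ []) ⟩
    (x ⁻¹ ∙ y ⁻¹) ∙ (x ∙ y)  ≈⟨ ∙-congˡ xy≈yx ⟩
    (x ⁻¹ ∙ y ⁻¹) ∙ (y ∙ x)  ≈⟨ solve ((x₀ ⁻ ⊙ x₁ ⁻) ⊙ (x₁ ⊙ x₀)) unit ≡.refl (x ∷ y ∷ []) ⟩
    ε                        ∎

  record IsSubgroup {k} (K : Carrier → Set k) : Set (c ⊔ ℓ ⊔ k) where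
    field
      ∈-resp : ∀ {x y} → x ≈ y → K x → K y
      ε∈     : K ε
      ∙∈     : ∀ {x y} → K x → K y → K (x ∙ y)
      ⁻¹∈    : ∀ {x} → K x → K (x ⁻¹)

  NormalisedBy : ∀ {k} → (Carrier → Set k) → Carrier → Set (c ⊔ k)
  NormalisedBy K x = ∀ {y} → K y → K (x ⁻¹ ∙ y ∙ x) × K (x ∙ y ∙ x ⁻¹)

  module _ {k} {K : Carrier → Set k} (K-subgroup : IsSubgroup K)
           (K-by-a : NormalisedBy K a) (K-by-b : NormalisedBy K b) (K∋⁅a,b⁆ : K ⁅ a , b ⁆) where

    open IsSubgroup K-subgroup

    private
      Generated : Carrier → Set (c ⊔ ℓ)
      Generated = ⟨ rawGroup ⟩ (Pair rawGroup a b)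

      ∈-resp˘ : ∀ {x y} → x ≈ y → K y → K x
      ∈-resp˘ x≈y = ∈-resp (sym x≈y)

      normalisedBy-resp : ∀ {x y} → x ≈ y → NormalisedBy K x → NormalisedBy K y
      normalisedBy-resp x≈y n Ky = ∈-resp (∙-cong (∙-congʳ (⁻¹-cong x≈y)) x≈y) (proj₁ (n Ky))
                                 , ∈-resp (∙-cong (∙-congʳ x≈y) (⁻¹-cong x≈y)) (proj₂ (n Ky))

      normalisedBy-generated : ∀ {x} → Generated x → NormalisedBy K x
      normalisedBy-generated (gen (fst x≈a)) = normalisedBy-resp (sym x≈a) K-by-a
      normalisedBy-generated (gen (snd x≈b)) = normalisedBy-resp (sym x≈b) K-by-b
      normalisedBy-generated one {y} Ky =
          ∈-resp˘ (solve (unit ⁻ ⊙ x₀ ⊙ unit) x₀ ≡.refl (y ∷ [])) Ky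
        , ∈-resp˘ (solve (unit ⊙ x₀ ⊙ unit ⁻) x₀ ≡.refl (y ∷ [])) Ky
      normalisedBy-generated (mul {u} {v} u∈ v∈) {y} Ky =
          ∈-resp˘ (solve ((x₀ ⊙ x₁) ⁻ ⊙ x₂ ⊙ (x₀ ⊙ x₁)) (x₁ ⁻ ⊙ (x₀ ⁻ ⊙ x₂ ⊙ x₀) ⊙ x₁) ≡.refl (u ∷ v ∷ y ∷ []))
                  (proj₁ (normalisedBy-generated v∈ (proj₁ (normalisedBy-generated u∈ Ky))))
        , ∈-resp˘ (solve ((x₀ ⊙ x₁) ⊙ x₂ ⊙ (x₀ ⊙ x₁) ⁻) (x₀ ⊙ (x₁ ⊙ x₂ ⊙ x₁ ⁻) ⊙ x₀ ⁻) ≡.refl (u ∷ v ∷ y ∷ []))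
                  (proj₂ (normalisedBy-generated u∈ (proj₂ (normalisedBy-generated v∈ Ky))))
      normalisedBy-generated (inv {u} u∈) {y} Ky =
          ∈-resp˘ (solve (x₀ ⁻ ⁻ ⊙ x₁ ⊙ x₀ ⁻) (x₀ ⊙ x₁ ⊙ x₀ ⁻) ≡.refl (u ∷ y ∷ [])) (proj₂ (normalisedBy-generated u∈ Ky))
        , ∈-resp˘ (solve (x₀ ⁻ ⊙ x₁ ⊙ x₀ ⁻ ⁻) (x₀ ⁻ ⊙ x₁ ⊙ x₀) ≡.refl (u ∷ y ∷ [])) (proj₁ (normalisedBy-generated u∈ Ky))
      normalisedBy-generated (resp x≈y x∈) = normalisedBy-resp x≈y (normalisedBy-generated x∈)

      ⁅,⁆∈-generated : ∀ {y} → (∀ {s} → Pair rawGroup a b s → K ⁅ s , y ⁆) → ∀ {x} → Generated x → K ⁅ x , y ⁆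
      ⁅,⁆∈-generated hyp (gen s) = hyp s
      ⁅,⁆∈-generated {y} hyp one = ∈-resp˘ (solve (unit ⁻ ⊙ x₀ ⁻ ⊙ unit ⊙ x₀) unit ≡.refl (y ∷ [])) ε∈
      ⁅,⁆∈-generated {y} hyp (mul {u} {v} u∈ v∈) =
        ∈-resp˘ (solve ((x₀ ⊙ x₁) ⁻ ⊙ x₂ ⁻ ⊙ (x₀ ⊙ x₁) ⊙ x₂)
                       (x₁ ⁻ ⊙ (x₀ ⁻ ⊙ x₂ ⁻ ⊙ x₀ ⊙ x₂) ⊙ x₁ ⊙ (x₁ ⁻ ⊙ x₂ ⁻ ⊙ x₁ ⊙ x₂)) ≡.refl (u ∷ v ∷ y ∷ []))
                (∙∈ (proj₁ (normalisedBy-generated v∈ (⁅,⁆∈-generated hyp u∈))) (⁅,⁆∈-generated hyp v∈))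
      ⁅,⁆∈-generated {y} hyp (inv {u} u∈) =
        ∈-resp˘ (solve (x₀ ⁻ ⁻ ⊙ x₁ ⁻ ⊙ x₀ ⁻ ⊙ x₁) (x₀ ⊙ (x₀ ⁻ ⊙ x₁ ⁻ ⊙ x₀ ⊙ x₁) ⁻ ⊙ x₀ ⁻) ≡.refl (u ∷ y ∷ []))
                (proj₂ (normalisedBy-generated u∈ (⁻¹∈ (⁅,⁆∈-generated hyp u∈))))
      ⁅,⁆∈-generated hyp (resp x≈x′ x∈) = ∈-resp (⁅,⁆-cong x≈x′ refl) (⁅,⁆∈-generated hyp x∈)

      ⁅,⁆∈-generators : ∀ {s t} → Pair rawGroup a b s → Pair rawGroup a b t → K ⁅ s , t ⁆
      ⁅,⁆∈-generators (fst s≈a) (fst t≈a) = ∈-resp˘ (trans (⁅,⁆-cong s≈a t≈a) (⁅x,x⁆≈ε a)) ε∈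
      ⁅,⁆∈-generators (snd s≈b) (snd t≈b) = ∈-resp˘ (trans (⁅,⁆-cong s≈b t≈b) (⁅x,x⁆≈ε b)) ε∈
      ⁅,⁆∈-generators (fst s≈a) (snd t≈b) = ∈-resp˘ (⁅,⁆-cong s≈a t≈b) K∋⁅a,b⁆
      ⁅,⁆∈-generators (snd s≈b) (fst t≈a) = ∈-resp˘ (trans (⁅,⁆-cong s≈b t≈a) (⁅,⁆-swap b a)) (⁻¹∈ K∋⁅a,b⁆)

      ⁅,⁆∈ : ∀ x y → K ⁅ x , y ⁆
      ⁅,⁆∈ x y = ⁅,⁆∈-generated ⁅s,y⁆∈ (generated x)
        where
        ⁅s,y⁆∈ : ∀ {s} → Pair rawGroup a b s → K ⁅ s , y ⁆
        ⁅s,y⁆∈ {s} s∈ = ∈-resp˘ (⁅,⁆-swap s y) (⁻¹∈ (⁅,⁆∈-generated (λ t∈ → ⁅,⁆∈-generators t∈ s∈) (generated y)))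

      ∈-commutatorSubgroup : ∀ {x} → ⟨ rawGroup ⟩ (IsCommutator rawGroup) x → K x
      ∈-commutatorSubgroup (gen (comm u v x≈⁅u,v⁆)) = ∈-resp˘ x≈⁅u,v⁆ (⁅,⁆∈ u v)
      ∈-commutatorSubgroup one          = ε∈
      ∈-commutatorSubgroup (mul x∈ y∈)  = ∙∈ (∈-commutatorSubgroup x∈) (∈-commutatorSubgroup y∈)
      ∈-commutatorSubgroup (inv x∈)     = ⁻¹∈ (∈-commutatorSubgroup x∈)
      ∈-commutatorSubgroup (resp x≈y x∈) = ∈-resp x≈y (∈-commutatorSubgroup x∈)

    normal⊇⁅a,b⁆⇒full : ∀ x → K x
    normal⊇⁅a,b⁆⇒full x = ∈-commutatorSubgroup (perfect x)

  ⁅a,b⁆≈ε⇒trivial : ⁅ a , b ⁆ ≈ ε → ∀ x → x ≈ ε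
  ⁅a,b⁆≈ε⇒trivial ⁅a,b⁆≈ε = normal⊇⁅a,b⁆⇒full trivial-subgroup trivial-normalised trivial-normalised ⁅a,b⁆≈ε
    where
    trivial-subgroup : IsSubgroup (_≈ ε)
    trivial-subgroup = record
      { ∈-resp = λ x≈y x≈ε → trans (sym x≈y) x≈ε
      ; ε∈     = refl
      ; ∙∈     = λ x≈ε y≈ε → trans (∙-cong x≈ε y≈ε) (identityʳ ε)
      ; ⁻¹∈    = λ x≈ε → trans (⁻¹-cong x≈ε) (solve (unit ⁻) unit ≡.refl [])
      }
    trivial-normalised : ∀ {x} → NormalisedBy (_≈ ε) x
    trivial-normalised {x} y≈ε = trans (∙-congʳ (∙-congˡ y≈ε)) (solve (x₀ ⁻ ⊙ unit ⊙ x₀) unit ≡.refl (x ∷ []))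
                               , trans (∙-congʳ (∙-congˡ y≈ε)) (solve (x₀ ⊙ unit ⊙ x₀ ⁻) unit ≡.refl (x ∷ []))

  _^_ : Carrier → ℕ → Carrier
  x ^ n = n Pow.× x

  PowerOf : Carrier → Carrier → Set ℓ
  PowerOf z x = ∃[ n ] x ≈ z ^ n

  ε^n≈ε : ∀ n → ε ^ n ≈ ε
  ε^n≈ε zero    = refl
  ε^n≈ε (suc n) = trans (identityˡ _) (ε^n≈ε n)

  ^-conj : ∀ x y n → x ⁻¹ ∙ y ^ n ∙ x ≈ (x ⁻¹ ∙ y ∙ x) ^ n
  ^-conj x y zero    = solve (x₀ ⁻ ⊙ unit ⊙ x₀) unit ≡.refl (x ∷ [])
  ^-conj x y (suc n) = begin
    x ⁻¹ ∙ (y ∙ y ^ n) ∙ x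
      ≈⟨ solve (x₀ ⁻ ⊙ (x₁ ⊙ x₂) ⊙ x₀) ((x₀ ⁻ ⊙ x₁ ⊙ x₀) ⊙ (x₀ ⁻ ⊙ x₂ ⊙ x₀)) ≡.refl (x ∷ y ∷ y ^ n ∷ []) ⟩
    (x ⁻¹ ∙ y ∙ x) ∙ (x ⁻¹ ∙ y ^ n ∙ x)   ≈⟨ ∙-congˡ (^-conj x y n) ⟩
    (x ⁻¹ ∙ y ∙ x) ∙ (x ⁻¹ ∙ y ∙ x) ^ n   ∎

  ^-conj′ : ∀ x y n → x ∙ y ^ n ∙ x ⁻¹ ≈ (x ∙ y ∙ x ⁻¹) ^ n
  ^-conj′ x y n = begin
    x ∙ y ^ n ∙ x ⁻¹            ≈⟨ ∙-congʳ (∙-congʳ (⁻¹-involutive x)) ⟨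
    x ⁻¹ ⁻¹ ∙ y ^ n ∙ x ⁻¹      ≈⟨ ^-conj (x ⁻¹) y n ⟩
    (x ⁻¹ ⁻¹ ∙ y ∙ x ⁻¹) ^ n    ≈⟨ Pow.×-congʳ n (∙-congʳ (∙-congʳ (⁻¹-involutive x))) ⟩
    (x ∙ y ∙ x ⁻¹) ^ n          ∎

  powers-commute : ∀ {z x y} → PowerOf z x → PowerOf z y → x ∙ y ≈ y ∙ x
  powers-commute {z} {x} {y} (m , x≈z^m) (n , y≈z^n) = begin
    x ∙ y          ≈⟨ ∙-cong x≈z^m y≈z^n ⟩
    z ^ m ∙ z ^ n  ≈⟨ Pow.×-homo-+ z m n ⟨
    z ^ (m + n)    ≡⟨ ≡.cong (z ^_) (+-comm m n) ⟩
    z ^ (n + m)    ≈⟨ Pow.×-homo-+ z n m ⟩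
    z ^ n ∙ z ^ m  ≈⟨ ∙-cong y≈z^n x≈z^m ⟨
    y ∙ x          ∎

  ConjugatesArePowersOf : Carrier → Carrier → Set ℓ
  ConjugatesArePowersOf z x = PowerOf z (x ⁻¹ ∙ z ∙ x) × PowerOf z (x ∙ z ∙ x ⁻¹)

  normal⟨⁅a,b⁆⟩⇒⁅a,b⁆≈ε : ∀ k → ⁅ a , b ⁆ ^ suc k ≈ ε →
    ConjugatesArePowersOf ⁅ a , b ⁆ a → ConjugatesArePowersOf ⁅ a , b ⁆ b → ⁅ a , b ⁆ ≈ ε
  normal⟨⁅a,b⁆⟩⇒⁅a,b⁆≈ε k z^1+k≈ε a-conj b-conj = commuting⇒⁅,⁆≈ε (powers-commute (every-power a) (every-power b))
    where
    z = ⁅ a , b ⁆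

    z^m∙z^km≈ε : ∀ m → z ^ m ∙ z ^ (k * m) ≈ ε
    z^m∙z^km≈ε m = begin
      z ^ m ∙ z ^ (k * m)  ≈⟨ Pow.×-homo-+ z m (k * m) ⟨
      z ^ (m + k * m)      ≡⟨ ≡.cong (z ^_) (≡.trans (≡.cong (m +_) (*-comm k m)) (≡.sym (*-suc m k))) ⟩
      z ^ (m * suc k)      ≈⟨ Pow.×-assocˡ z m (suc k) ⟨
      (z ^ suc k) ^ m      ≈⟨ Pow.×-congʳ m z^1+k≈ε ⟩
      ε ^ m                ≈⟨ ε^n≈ε m ⟩
      ε                    ∎

    powers-subgroup : IsSubgroup (PowerOf z)
    powers-subgroup = record
      { ∈-resp = λ { x≈y (n , x≈z^n) → n , trans (sym x≈y) x≈z^n }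
      ; ε∈     = 0 , refl
      ; ∙∈     = λ { (m , x≈z^m) (n , y≈z^n) → m + n , trans (∙-cong x≈z^m y≈z^n) (sym (Pow.×-homo-+ z m n)) }
      ; ⁻¹∈    = λ { (m , x≈z^m) → k * m , trans (⁻¹-cong x≈z^m) (sym (inverseʳ-unique _ _ (z^m∙z^km≈ε m))) }
      }

    powers-normalisedBy : ∀ {x} → ConjugatesArePowersOf z x → NormalisedBy (PowerOf z) x
    powers-normalisedBy {x} ((m , x⁻¹zx≈z^m) , (m′ , xzx⁻¹≈z^m′)) (n , y≈z^n) =
        (n * m  , trans (∙-congʳ (∙-congˡ y≈z^n))
                        (trans (^-conj x z n) (trans (Pow.×-congʳ n x⁻¹zx≈z^m) (Pow.×-assocˡ z n m))))
      , (n * m′ , trans (∙-congʳ (∙-congˡ y≈z^n))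
                        (trans (^-conj′ x z n) (trans (Pow.×-congʳ n xzx⁻¹≈z^m′) (Pow.×-assocˡ z n m′))))

    every-power : ∀ x → PowerOf z x
    every-power = normal⊇⁅a,b⁆⇒full powers-subgroup (powers-normalisedBy a-conj) (powers-normalisedBy b-conj)
                    (1 , sym (Pow.×-homo-1 z))

module Exploration {s b} {S : Set s} (_≟_ : DecidableEquality S) (next : S → List S)
  (Blocked : S → Set b) (blocked? : Decidable Blocked) where

  open import Data.List.Membership.DecPropositional _≟_ using (_∈?_)

  -- explore n fuel visited t: each walk of at most fuel steps from t, a state at depth n, either
  -- revisits a state (of visited or of the walk) or meets only Blocked states at depths ≥ 2.
  closingExcluded : ℕ → S → Bool
  closingExcluded n t = (n <ᵇ 2) ∨ ⌊ blocked? t ⌋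

  explore : (depth fuel : ℕ) → List S → S → Bool
  explore n zero       visited t = closingExcluded n t
  explore n (suc fuel) visited t = closingExcluded n t
    ∧ all (λ t′ → ⌊ t′ ∈? (t ∷ visited) ⌋ ∨ explore (suc n) fuel (t ∷ visited) t′) (next t)

  private
    explore⇒closingExcluded : ∀ {n} fuel {visited t} → T (explore n fuel visited t) → T (closingExcluded n t)
    explore⇒closingExcluded zero    ok = ok
    explore⇒closingExcluded (suc _) ok = proj₁ (Equivalence.to T-∧ ok)

  module _ {r} (k : ℕ) (2≤k : 2 ≤ k) (Reached : ℕ → S → Set r) (start : S) (reached-start : Reached 0 start)
    (reached-next      : ∀ {n t} → n < k → Reached n t → ∃[ t′ ] t′ ∈ next t × Reached (suc n) t′)
    (reached-injective : ∀ {m n t} → m ≤ k → n ≤ k → Reached m t → Reached n t → m ≡ n)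
    (reached-unblocked : ∀ {t} → Reached k t → ¬ Blocked t) where

    private
      VisitedBefore : ℕ → List S → Set (s ⊔ r)
      VisitedBefore n visited = ∀ {t} → t ∈ visited → ∃[ m ] m < n × Reached m t

      closing-impossible : ∀ {t} → Reached k t → ¬ T (closingExcluded k t)
      closing-impossible reached excluded with Equivalence.to T-∨ excluded
      ... | inj₁ k<2     = ≤⇒≯ 2≤k (<ᵇ⇒< k 2 k<2)
      ... | inj₂ blocked = reached-unblocked reached (toWitness blocked)

      explore-step : ∀ {n fuel visited t t′} → T (explore n (suc fuel) visited t) → t′ ∈ next t →
                     t′ ∈ t ∷ visited ⊎ T (explore (suc n) fuel (t ∷ visited) t′)
      explore-step {visited = visited} {t} {t′} ok t′∈next =
        Sum.map₁ (toWitness {a? = t′ ∈? (t ∷ visited)})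
          (Equivalence.to T-∨ (All.lookup (all⁺ _ (next t) (proj₂ (Equivalence.to T-∧ ok))) t′∈next))

      no-revisit : ∀ {n t t′ visited} → n < k → VisitedBefore n visited → Reached n t → Reached (suc n) t′ →
                   ¬ t′ ∈ t ∷ visited
      no-revisit {n} n<k before reached reached′ (here ≡.refl) =
        <-irrefl (reached-injective (<⇒≤ n<k) n<k reached reached′) (n<1+n n)
      no-revisit n<k before reached reached′ (there t′∈visited) =
        let m , m<n , reachedₘ = before t′∈visited
        in  <-irrefl (reached-injective (≤-trans (<⇒≤ m<n) (<⇒≤ n<k)) n<k reachedₘ reached′) (m<n⇒m<1+n m<n)

      visit : ∀ {n t visited} → VisitedBefore n visited → Reached n t → VisitedBefore (suc n) (t ∷ visited)
      visit {n} before reached (here ≡.refl)     = n , n<1+n n , reached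
      visit     before reached (there t′∈visited) =
        let m , m<n , reachedₘ = before t′∈visited in m , m<n⇒m<1+n m<n , reachedₘ

      sound : ∀ fuel n visited t → n ≤ k → k ≤ n + fuel → VisitedBefore n visited → Reached n t →
              ¬ T (explore n fuel visited t)
      sound fuel n visited t n≤k k≤n+fuel before reached ok with m≤n⇒m<n∨m≡n n≤k
      ... | inj₂ ≡.refl = closing-impossible reached (explore⇒closingExcluded fuel ok)
      sound zero n visited t n≤k k≤n+0 before reached ok | inj₁ n<k =
        <-irrefl ≡.refl (≤-<-trans (≡.subst (k ≤_) (+-identityʳ n) k≤n+0) n<k)
      sound (suc fuel) n visited t n≤k k≤n+1+fuel before reached ok | inj₁ n<k =
        let t′ , t′∈next , reached′ = reached-next n<k reached
        in  [ no-revisit n<k before reached reached′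
            , sound fuel (suc n) (t ∷ visited) t′ n<k (≡.subst (k ≤_) (+-suc n fuel) k≤n+1+fuel)
                    (visit before reached) reached′
            ]′ (explore-step {n} {fuel} ok t′∈next)

    explore-sound : ∀ fuel → k ≤ fuel → ¬ T (explore 0 fuel [] start)
    explore-sound fuel k≤fuel = sound fuel 0 [] start z≤n k≤fuel (λ ()) reached-start

-- m, l and L stand for μ, λ and λ⁻¹.
data Letter : Set where
  m l L : Letter

Word : Set
Word = List Letter

_≟ˡ_ : DecidableEquality Letter
m ≟ˡ m = yes ≡.refl
m ≟ˡ l = no λ ()
m ≟ˡ L = no λ ()
l ≟ˡ m = no λ ()
l ≟ˡ l = yes ≡.refl
l ≟ˡ L = no λ ()
L ≟ˡ m = no λ ()
L ≟ˡ l = no λ ()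
L ≟ˡ L = yes ≡.refl

_≟ʷ_ : DecidableEquality Word
_≟ʷ_ = List.≡-dec _≟ˡ_

-- Reduced words, without m m and without two adjacent letters from {l, L}, are the normal forms
-- of ⟨μ, λ | μ², λ³⟩ ≅ ℤ/2 ∗ ℤ/3; prepending keeps a word reduced.
prepend : Letter → Word → Word
prepend m (m ∷ w) = w
prepend m w       = m ∷ w
prepend l (l ∷ w) = L ∷ w
prepend l (L ∷ w) = w
prepend l w       = l ∷ w
prepend L (L ∷ w) = l ∷ w
prepend L (l ∷ w) = w
prepend L w       = L ∷ w

reduce : Word → Word
reduce []      = []
reduce (x ∷ w) = prepend x (reduce w)

invertLetter : Letter → Letter
invertLetter m = m
invertLetter l = L
invertLetter L = l

invert : Word → Word
invert []      = []
invert (x ∷ w) = invert w ++ [ invertLetter x ]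

-- Words for μ, ⁅μ,λ⁆⁻¹ and (λ⁻¹⁅μ,λ⁆λ)⁅μ,λ⁆⁻¹, using μ⁻¹ = μ.
coreWords : List Word
coreWords = (m ∷ []) ∷ (L ∷ m ∷ l ∷ m ∷ []) ∷ (L ∷ m ∷ L ∷ m ∷ l ∷ m ∷ l ∷ m ∷ []) ∷ []

coreWord? : ∀ w → Dec (w ∈ coreWords)
coreWord? w = Any.any? (w ≟ʷ_) coreWords

provablyNontrivial : Word → Bool
provablyNontrivial d = any (λ u → ⌊ coreWord? (reduce (invert u ++ (d ++ u))) ⌋) (inits d)

module WordEvaluation {c ℓ} (P : Group c ℓ) (μ λ' : Group.Carrier P)
  (μ-order : HasOrder2 P μ) (λ-order : HasOrder3 P λ') where

  open Group P
  open import Algebra.Properties.Group P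
  open import Relation.Binary.Reasoning.Setoid setoid
  open FreeGroupSolver P using (Expr; var; unit; _⊙_; _⁻; ⟦_⟧)

  ⟦_⟧ˡ : Letter → Carrier
  ⟦ m ⟧ˡ = μ
  ⟦ l ⟧ˡ = λ'
  ⟦ L ⟧ˡ = λ' ⁻¹

  eval : Word → Carrier
  eval []      = ε
  eval (x ∷ w) = ⟦ x ⟧ˡ ∙ eval w

  eval-++ : ∀ u v → eval (u ++ v) ≈ eval u ∙ eval v
  eval-++ []      v = sym (identityˡ _)
  eval-++ (x ∷ u) v = trans (∙-congˡ (eval-++ u v)) (sym (assoc _ _ _))

  μλ : Vec Carrier 2
  μλ = μ ∷ λ' ∷ []

  toWord : Expr 2 → Word
  toWord (var zero)       = [ m ]
  toWord (var (suc zero)) = [ l ]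
  toWord unit             = []
  toWord (x ⊙ y)          = toWord x ++ toWord y
  toWord (x ⁻)            = invert (toWord x)

  private
    μ²≈ε : μ ∙ μ ≈ ε
    μ²≈ε = proj₂ μ-order

    μ≈μ⁻¹ : μ ≈ μ ⁻¹
    μ≈μ⁻¹ = inverseˡ-unique _ _ μ²≈ε

    λλ≈λ⁻¹ : λ' ∙ λ' ≈ λ' ⁻¹
    λλ≈λ⁻¹ = inverseˡ-unique _ _ (proj₂ λ-order)

    cancelˡ : ∀ {x y} w → x ∙ y ≈ ε → w ≈ x ∙ (y ∙ w)
    cancelˡ {x} {y} w xy≈ε = begin
      w              ≈⟨ identityˡ w ⟨
      ε ∙ w          ≈⟨ ∙-congʳ xy≈ε ⟨
      (x ∙ y) ∙ w    ≈⟨ assoc x y w ⟩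
      x ∙ (y ∙ w)    ∎

  prepend-sound : ∀ x w → eval (prepend x w) ≈ ⟦ x ⟧ˡ ∙ eval w
  prepend-sound m (m ∷ w) = cancelˡ (eval w) μ²≈ε
  prepend-sound m []      = refl
  prepend-sound m (l ∷ w) = refl
  prepend-sound m (L ∷ w) = refl
  prepend-sound l (l ∷ w) = trans (∙-congʳ (sym λλ≈λ⁻¹)) (assoc _ _ _)
  prepend-sound l (L ∷ w) = cancelˡ (eval w) (inverseʳ λ')
  prepend-sound l []      = refl
  prepend-sound l (m ∷ w) = refl
  prepend-sound L (L ∷ w) = begin
    λ' ∙ eval w                    ≈⟨ ∙-congʳ (⁻¹-involutive λ') ⟨
    λ' ⁻¹ ⁻¹ ∙ eval w              ≈⟨ ∙-congʳ (⁻¹-cong λλ≈λ⁻¹) ⟨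
    (λ' ∙ λ') ⁻¹ ∙ eval w          ≈⟨ ∙-congʳ (⁻¹-anti-homo-∙ λ' λ') ⟩
    (λ' ⁻¹ ∙ λ' ⁻¹) ∙ eval w       ≈⟨ assoc _ _ _ ⟩
    λ' ⁻¹ ∙ (λ' ⁻¹ ∙ eval w)       ∎
  prepend-sound L (l ∷ w) = cancelˡ (eval w) (inverseˡ λ')
  prepend-sound L []      = refl
  prepend-sound L (m ∷ w) = refl

  reduce-sound : ∀ w → eval (reduce w) ≈ eval w
  reduce-sound []      = refl
  reduce-sound (x ∷ w) = trans (prepend-sound x (reduce w)) (∙-congˡ (reduce-sound w))

  invertLetter-sound : ∀ x → ⟦ invertLetter x ⟧ˡ ≈ ⟦ x ⟧ˡ ⁻¹
  invertLetter-sound m = μ≈μ⁻¹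
  invertLetter-sound l = refl
  invertLetter-sound L = sym (⁻¹-involutive λ')

  invert-sound : ∀ w → eval (invert w) ≈ eval w ⁻¹
  invert-sound []      = sym ε⁻¹≈ε
  invert-sound (x ∷ w) = begin
    eval (invert w ++ [ invertLetter x ])      ≈⟨ eval-++ (invert w) _ ⟩
    eval (invert w) ∙ (⟦ invertLetter x ⟧ˡ ∙ ε)
      ≈⟨ ∙-cong (invert-sound w) (trans (identityʳ _) (invertLetter-sound x)) ⟩
    eval w ⁻¹ ∙ ⟦ x ⟧ˡ ⁻¹                      ≈⟨ ⁻¹-anti-homo-∙ _ _ ⟨
    (⟦ x ⟧ˡ ∙ eval w) ⁻¹                       ∎

  toWord-sound : ∀ e → eval (toWord e) ≈ ⟦ e ⟧ μλ
  toWord-sound (var zero)       = identityʳ μ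
  toWord-sound (var (suc zero)) = identityʳ λ'
  toWord-sound unit             = refl
  toWord-sound (x ⊙ y)          =
    trans (eval-++ (toWord x) (toWord y)) (∙-cong (toWord-sound x) (toWord-sound y))
  toWord-sound (x ⁻)            = trans (invert-sound (toWord x)) (⁻¹-cong (toWord-sound x))

  reduce-≡⇒≈ : ∀ u v → reduce u ≡ reduce v → eval u ≈ eval v
  reduce-≡⇒≈ u v eq = begin
    eval u             ≈⟨ reduce-sound u ⟨
    eval (reduce u)    ≡⟨ ≡.cong eval eq ⟩
    eval (reduce v)    ≈⟨ reduce-sound v ⟩
    eval v             ∎

  solveModRelations : ∀ (x y : Expr 2) → reduce (toWord x) ≡ reduce (toWord y) → ⟦ x ⟧ μλ ≈ ⟦ y ⟧ μλ
  solveModRelations x y eq =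
    trans (sym (toWord-sound x)) (trans (reduce-≡⇒≈ (toWord x) (toWord y) eq) (toWord-sound y))

  eval≈⟦⟧ : ∀ w (e : Expr 2) → reduce w ≡ reduce (toWord e) → eval w ≈ ⟦ e ⟧ μλ
  eval≈⟦⟧ w e eq = trans (reduce-≡⇒≈ w (toWord e) eq) (toWord-sound e)

  conjugate≈ε : ∀ u w → eval w ≈ ε → eval (invert u ++ (w ++ u)) ≈ ε
  conjugate≈ε u w w≈ε = begin
    eval (invert u ++ (w ++ u))             ≈⟨ eval-++ (invert u) _ ⟩
    eval (invert u) ∙ eval (w ++ u)         ≈⟨ ∙-cong (invert-sound u) (eval-++ w u) ⟩
    eval u ⁻¹ ∙ (eval w ∙ eval u)           ≈⟨ ∙-congˡ (∙-congʳ w≈ε) ⟩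
    eval u ⁻¹ ∙ (ε ∙ eval u)                ≈⟨ ∙-congˡ (identityˡ _) ⟩
    eval u ⁻¹ ∙ eval u                      ≈⟨ inverseˡ _ ⟩
    ε                                       ∎

module Nontriviality {c ℓ} (P : Group c ℓ) (μ λ' : Group.Carrier P)
  (perfect : Perfect P) (generated : GeneratedBy P μ λ')
  (μ-order : HasOrder2 P μ) (λ-order : HasOrder3 P λ') where

  open Group P
  open import Algebra.Properties.Group P using (inverseʳ-unique; ⁻¹-injective; ε⁻¹≈ε; x∙y⁻¹≈ε⇒x≈y)
  open import Relation.Binary.Reasoning.Setoid setoid
  open FreeGroupSolver P using (Expr; unit; _⊙_; _⁻; x₀; x₁; solve)
  open PerfectTwoGenerated P μ λ' perfect generated
  open WordEvaluation P μ λ' μ-order λ-order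

  zᵉ : Expr 2
  zᵉ = x₀ ⁻ ⊙ x₁ ⁻ ⊙ x₀ ⊙ x₁

  ⁅μ,λ⁆≉ε : ¬ ⁅ μ , λ' ⁆ ≈ ε
  ⁅μ,λ⁆≉ε ⁅μ,λ⁆≈ε = proj₁ μ-order (⁅a,b⁆≈ε⇒trivial ⁅μ,λ⁆≈ε μ)

  -- If λ centralised z = ⁅μ,λ⁆ then z³ ≈ z ∙ (λ⁻¹ z λ) ∙ (λ z λ⁻¹), which is trivial modulo
  -- μ² = λ³ = 1, while μ inverts z; so ⟨z⟩ would be a normal subgroup of order dividing 3.
  λ⁻¹⁅μ,λ⁆λ≉⁅μ,λ⁆ : ¬ λ' ⁻¹ ∙ ⁅ μ , λ' ⁆ ∙ λ' ≈ ⁅ μ , λ' ⁆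
  λ⁻¹⁅μ,λ⁆λ≉⁅μ,λ⁆ λ⁻¹zλ≈z = ⁅μ,λ⁆≉ε (normal⟨⁅a,b⁆⟩⇒⁅a,b⁆≈ε 2 z³≈ε μ-conjugates λ-conjugates)
    where
    z = ⁅ μ , λ' ⁆

    λzλ⁻¹≈z : λ' ∙ z ∙ λ' ⁻¹ ≈ z
    λzλ⁻¹≈z = begin
      λ' ∙ z ∙ λ' ⁻¹                        ≈⟨ ∙-congʳ (∙-congˡ λ⁻¹zλ≈z) ⟨
      λ' ∙ (λ' ⁻¹ ∙ z ∙ λ') ∙ λ' ⁻¹         ≈⟨ solve (x₁ ⊙ (x₁ ⁻ ⊙ x₀ ⊙ x₁) ⊙ x₁ ⁻) x₀ ≡.refl (z ∷ λ' ∷ []) ⟩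
      z                                     ∎

    z³≈ε : z ^ 3 ≈ ε
    z³≈ε = begin
      z ∙ (z ∙ (z ∙ ε))                                          ≈⟨ ∙-congˡ (∙-cong λ⁻¹zλ≈z (∙-congʳ λzλ⁻¹≈z)) ⟨
      z ∙ ((λ' ⁻¹ ∙ z ∙ λ') ∙ ((λ' ∙ z ∙ λ' ⁻¹) ∙ ε))
        ≈⟨ solveModRelations (zᵉ ⊙ ((x₁ ⁻ ⊙ zᵉ ⊙ x₁) ⊙ ((x₁ ⊙ zᵉ ⊙ x₁ ⁻) ⊙ unit))) unit ≡.refl ⟩
      ε                                                          ∎

    z⁻¹≈z² : z ⁻¹ ≈ z ^ 2
    z⁻¹≈z² = sym (inverseʳ-unique z (z ^ 2) z³≈ε)

    μ-conjugates : ConjugatesArePowersOf z μ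
    μ-conjugates = (2 , trans (solveModRelations (x₀ ⁻ ⊙ zᵉ ⊙ x₀) (zᵉ ⁻) ≡.refl) z⁻¹≈z²)
                 , (2 , trans (solveModRelations (x₀ ⊙ zᵉ ⊙ x₀ ⁻) (zᵉ ⁻) ≡.refl) z⁻¹≈z²)

    λ-conjugates : ConjugatesArePowersOf z λ'
    λ-conjugates = (1 , trans λ⁻¹zλ≈z (sym (identityʳ z))) , (1 , trans λzλ⁻¹≈z (sym (identityʳ z)))

  coreWord-nontrivial : ∀ {w} → w ∈ coreWords → ¬ eval w ≈ ε
  coreWord-nontrivial (here ≡.refl) μ∙ε≈ε = proj₁ μ-order (trans (sym (identityʳ μ)) μ∙ε≈ε)
  coreWord-nontrivial (there (here ≡.refl)) w≈ε = ⁅μ,λ⁆≉ε (⁻¹-injective (begin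
    ⁅ μ , λ' ⁆ ⁻¹                 ≈⟨ eval≈⟦⟧ (L ∷ m ∷ l ∷ m ∷ []) (zᵉ ⁻) ≡.refl ⟨
    eval (L ∷ m ∷ l ∷ m ∷ [])     ≈⟨ w≈ε ⟩
    ε                             ≈⟨ ε⁻¹≈ε ⟨
    ε ⁻¹                          ∎))
  coreWord-nontrivial (there (there (here ≡.refl))) w≈ε = λ⁻¹⁅μ,λ⁆λ≉⁅μ,λ⁆ (x∙y⁻¹≈ε⇒x≈y _ _ (begin
    (λ' ⁻¹ ∙ ⁅ μ , λ' ⁆ ∙ λ') ∙ ⁅ μ , λ' ⁆ ⁻¹
      ≈⟨ eval≈⟦⟧ (L ∷ m ∷ L ∷ m ∷ l ∷ m ∷ l ∷ m ∷ []) ((x₁ ⁻ ⊙ zᵉ ⊙ x₁) ⊙ zᵉ ⁻) ≡.refl ⟨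
    eval (L ∷ m ∷ L ∷ m ∷ l ∷ m ∷ l ∷ m ∷ [])   ≈⟨ w≈ε ⟩
    ε                                             ∎))

  provablyNontrivial-sound : ∀ d → T (provablyNontrivial d) → ¬ eval d ≈ ε
  provablyNontrivial-sound d certificate d≈ε =
    let u , core = satisfied (any⁻ _ (inits d) certificate)
    in  coreWord-nontrivial (toWitness {a? = coreWord? (reduce (invert u ++ (d ++ u)))} core)
                            (trans (reduce-sound (invert u ++ (d ++ u))) (conjugate≈ε u d d≈ε))

module WreathGroup {c ℓ} (P : Group c ℓ) where

  private module P = Group P
  open Wreath P

  -- _≈W_ is not injective in its arguments, which defeats inference of implicit elements.
  infix 4 _≋_
  record _≋_ (x y : Elt) : Set ℓ where
    constructor wrap
    field unwrap : x ≈W y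
  open _≋_ public

  private
    ≈W-refl : ∀ {x} → x ≈W x
    ≈W-refl = (λ _ → P.refl) , (λ _ → ≡.refl)

    ≈W-sym : ∀ {x y} → x ≈W y → y ≈W x
    ≈W-sym (b , t) = (λ i → P.sym (b i)) , (λ i → ≡.sym (t i))

    ≈W-trans : ∀ {x y z} → x ≈W y → y ≈W z → x ≈W z
    ≈W-trans (b , t) (b′ , t′) = (λ i → P.trans (b i) (b′ i)) , (λ i → ≡.trans (t i) (t′ i))

    ∙W-cong : ∀ {x x′ y y′} → x ≈W x′ → y ≈W y′ → (x ∙W y) ≈W (x′ ∙W y′)
    ∙W-cong {t ⋊ π} {t′ ⋊ π′} {s ⋊ σ} {s′ ⋊ σ′} (b , p) (b′ , q) =
        (λ i → P.∙-cong (b i) (P.trans (b′ (π ⟨$⟩ʳ i)) (P.reflexive (≡.cong s′ (p i)))))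
      , (λ i → ≡.trans (q (π ⟨$⟩ʳ i)) (≡.cong (σ′ ⟨$⟩ʳ_) (p i)))

    ⟨$⟩ˡ-cong : ∀ (π π′ : Permutation′ 5) → (∀ i → π ⟨$⟩ʳ i ≡ π′ ⟨$⟩ʳ i) → ∀ j → π ⟨$⟩ˡ j ≡ π′ ⟨$⟩ˡ j
    ⟨$⟩ˡ-cong π π′ π≗π′ j = begin
      π ⟨$⟩ˡ j                       ≡⟨ ≡.cong (π ⟨$⟩ˡ_) (Perm.inverseʳ π′) ⟨
      π ⟨$⟩ˡ (π′ ⟨$⟩ʳ (π′ ⟨$⟩ˡ j))    ≡⟨ ≡.cong (π ⟨$⟩ˡ_) (π≗π′ (π′ ⟨$⟩ˡ j)) ⟨
      π ⟨$⟩ˡ (π ⟨$⟩ʳ (π′ ⟨$⟩ˡ j))     ≡⟨ Perm.inverseˡ π ⟩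
      π′ ⟨$⟩ˡ j                      ∎
      where open ≡.≡-Reasoning

    ⁻¹W-cong : ∀ {x y} → x ≈W y → (x ⁻¹W) ≈W (y ⁻¹W)
    ⁻¹W-cong {t ⋊ π} {t′ ⋊ π′} (b , p) =
        (λ j → P.⁻¹-cong (P.trans (b (π ⟨$⟩ˡ j)) (P.reflexive (≡.cong t′ (⟨$⟩ˡ-cong π π′ p j)))))
      , ⟨$⟩ˡ-cong π π′ p

    ∙W-inverseʳ : ∀ x → (x ∙W (x ⁻¹W)) ≈W εW
    ∙W-inverseʳ (t ⋊ π) =
        (λ i → P.trans (P.∙-congˡ (P.reflexive (≡.cong (λ k → t k P.⁻¹) (Perm.inverseˡ π)))) (P.inverseʳ _))
      , (λ _ → Perm.inverseˡ π)

  wreathGroup : Group c ℓ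
  wreathGroup = record
    { Carrier = Elt ; _≈_ = _≋_ ; _∙_ = _∙W_ ; ε = εW ; _⁻¹ = _⁻¹W
    ; isGroup = record
      { isMonoid = record
        { isSemigroup = record
          { isMagma = record
            { isEquivalence = record
              { refl  = λ {x} → wrap (≈W-refl {x})
              ; sym   = λ {x} {y} x≋y → wrap (≈W-sym {x} {y} (unwrap x≋y))
              ; trans = λ {x} {y} {z} x≋y y≋z → wrap (≈W-trans {x} {y} {z} (unwrap x≋y) (unwrap y≋z))
              }
            ; ∙-cong = λ {x} {x′} {y} {y′} x≋x′ y≋y′ →
                         wrap (∙W-cong {x} {x′} {y} {y′} (unwrap x≋x′) (unwrap y≋y′))
            }
          ; assoc = λ { (t ⋊ π) (s ⋊ σ) (r ⋊ ρ) → wrap ((λ _ → P.assoc _ _ _) , (λ _ → ≡.refl)) }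
          }
        ; identity = (λ { (t ⋊ π) → wrap ((λ _ → P.identityˡ _) , (λ _ → ≡.refl)) })
                   , (λ { (t ⋊ π) → wrap ((λ _ → P.identityʳ _) , (λ _ → ≡.refl)) })
        }
      ; inverse = (λ { (t ⋊ π) → wrap ((λ _ → P.inverseˡ _) , (λ _ → Perm.inverseʳ π)) })
                , (λ x → wrap (∙W-inverseʳ x))
      ; ⁻¹-cong = λ {x} {y} x≋y → wrap (⁻¹W-cong {x} {y} (unwrap x≋y))
      }
    }

-- code ws τ stands for the element with coordinates eval wsᵢ and permutation i ↦ τᵢ. A data type
-- rather than a record: eta-expanding unknown codes would make _·_ unfold during type checking.
data Code : Set where
  code : (words : Vec Word 5) (images : Vec (Fin 5) 5) → Code

words : Code → Vec Word 5
words (code ws _) = ws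

images : Code → Vec (Fin 5) 5
images (code _ τ) = τ

infixl 7 _·_
_·_ : Code → Code → Code
code t τ · code s σ = code (tabulate λ i → reduce (lookup t i ++ lookup s (lookup τ i)))
                           (tabulate (lookup σ ∘ lookup τ))

infix 4 _≟ᶜ_
_≟ᶜ_ : DecidableEquality Code
code t τ ≟ᶜ code s σ = map′ (uncurry (≡.cong₂ code)) (λ { ≡.refl → ≡.refl , ≡.refl })
                            (Vec.≡-dec _≟ʷ_ t s ×-dec Vec.≡-dec _≟ᶠ_ τ σ)

quotientNontrivial : Word → Word → Bool
quotientNontrivial u v = provablyNontrivial (reduce (u ++ invert v))

Apart : Code → Code → Set
Apart (code t τ) (code s σ) = ∃[ i ] (lookup τ i ≢ lookup σ i ⊎ T (quotientNontrivial (lookup t i) (lookup s i)))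

apart? : ∀ s t → Dec (Apart s t)
apart? (code t τ) (code s σ) =
  any? λ i → ¬? (lookup τ i ≟ᶠ lookup σ i) ⊎-dec T? (quotientNontrivial (lookup t i) (lookup s i))

-- Images are listed for the points 1, …, 5, that is, Fin indices 0, …, 4.
idᶜ h₁ᶜ h₂ᶜ gᶜ : Code
idᶜ = code ([]    ∷ []    ∷ []    ∷ []    ∷ []    ∷ []) (# 0 ∷ # 1 ∷ # 2 ∷ # 3 ∷ # 4 ∷ [])
h₁ᶜ = code ([]    ∷ []    ∷ []    ∷ [ l ] ∷ [ L ] ∷ []) (# 1 ∷ # 2 ∷ # 0 ∷ # 3 ∷ # 4 ∷ [])
h₂ᶜ = code ([ m ] ∷ [ m ] ∷ [ m ] ∷ []    ∷ []    ∷ []) (# 1 ∷ # 0 ∷ # 2 ∷ # 4 ∷ # 3 ∷ [])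
gᶜ  = code ([]    ∷ [ m ] ∷ []    ∷ []    ∷ [ m ] ∷ []) (# 3 ∷ # 4 ∷ # 2 ∷ # 0 ∷ # 1 ∷ [])

hCodes : Vec Code 6
hCodes = idᶜ ∷ h₁ᶜ ∷ h₁ᶜ · h₁ᶜ ∷ h₂ᶜ ∷ h₁ᶜ · h₂ᶜ ∷ h₂ᶜ · h₁ᶜ ∷ []

-- Opaque, like the search and the concrete cycle below, so that the type checker never
-- unfolds the computation where only its statement matters.
opaque
  hCodes-closed : ∀ i j → ∃[ k ] lookup hCodes i · lookup hCodes j ≡ lookup hCodes k
  hCodes-closed =
    toWitness {a? = all? λ i → all? λ j → any? λ k → lookup hCodes i · lookup hCodes j ≟ᶜ lookup hCodes k} _

  hCodes-inverse : ∀ i → ∃[ k ] lookup hCodes i · lookup hCodes k ≡ idᶜ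
  hCodes-inverse = toWitness {a? = all? λ i → any? λ k → lookup hCodes i · lookup hCodes k ≟ᶜ idᶜ} _

NotInH : Code → Set
NotInH s = ∀ k → Apart s (lookup hCodes k)

notInH? : ∀ s → Dec (NotInH s)
notInH? s = all? λ k → apart? s (lookup hCodes k)

CosetsApart : Code → Code → Set
CosetsApart s t = ∀ k → Apart s (lookup hCodes k · t)

cosetsApart? : ∀ s t → Dec (CosetsApart s t)
cosetsApart? s t = all? λ k → apart? s (lookup hCodes k · t)

module Denotation {c ℓ} (P : Group c ℓ) (μ λ' : Group.Carrier P)
  (perfect : Perfect P) (generated : GeneratedBy P μ λ')
  (μ-order : HasOrder2 P μ) (λ-order : HasOrder3 P λ') where

  open Group P
  open import Algebra.Properties.Group P using (x≈y⇒x∙y⁻¹≈ε)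
  open import Relation.Binary.Reasoning.Setoid setoid
  open Wreath P
  open Setup μ λ'
  open WreathGroup P
  private module W = Group wreathGroup
  open FreeGroupSolver wreathGroup using (_⊙_; _⁻; x₀; x₁; solve)
  open import Algebra.Properties.Group wreathGroup using () renaming (inverseʳ-unique to W-inverseʳ-unique)
  open WordEvaluation P μ λ' μ-order λ-order
  open Nontriviality P μ λ' perfect generated μ-order λ-order using (provablyNontrivial-sound)

  record Denotes (s : Code) (x : Elt) : Set ℓ where
    constructor denotes
    field
      base≈ : ∀ i → base x i ≈ eval (lookup (words s) i)
      top≡  : ∀ i → top x ⟨$⟩ʳ i ≡ lookup (images s) i

  denotes-∙ : ∀ {s t x y} → Denotes s x → Denotes t y → Denotes (s · t) (x ∙W y)
  denotes-∙ {code t τ} {code s σ} {u ⋊ π} {v ⋊ ρ} (denotes u≈t π≡τ) (denotes v≈s ρ≡σ) = denotes base≈′ top≡′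
    where
    w : Fin 5 → Word
    w i = lookup t i ++ lookup s (lookup τ i)

    base≈′ : ∀ i → u i ∙ v (π ⟨$⟩ʳ i) ≈ eval (lookup (tabulate (reduce ∘ w)) i)
    base≈′ i = begin
      u i ∙ v (π ⟨$⟩ʳ i)                                ≈⟨ ∙-cong (u≈t i) (v≈s (π ⟨$⟩ʳ i)) ⟩
      eval (lookup t i) ∙ eval (lookup s (π ⟨$⟩ʳ i))
        ≡⟨ ≡.cong (λ j → eval (lookup t i) ∙ eval (lookup s j)) (π≡τ i) ⟩
      eval (lookup t i) ∙ eval (lookup s (lookup τ i))  ≈⟨ eval-++ (lookup t i) _ ⟨
      eval (w i)                                        ≈⟨ reduce-sound (w i) ⟨
      eval (reduce (w i))                               ≡⟨ ≡.cong eval (lookup∘tabulate (reduce ∘ w) i) ⟨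
      eval (lookup (tabulate (reduce ∘ w)) i)           ∎

    top≡′ : ∀ i → ρ ⟨$⟩ʳ (π ⟨$⟩ʳ i) ≡ lookup (tabulate (lookup σ ∘ lookup τ)) i
    top≡′ i = ≡.trans (ρ≡σ (π ⟨$⟩ʳ i))
                (≡.trans (≡.cong (lookup σ) (π≡τ i)) (≡.sym (lookup∘tabulate (lookup σ ∘ lookup τ) i)))

  denotes-unique : ∀ {s x y} → Denotes s x → Denotes s y → x ≋ y
  denotes-unique (denotes x≈s x≡s) (denotes y≈s y≡s) =
    wrap ((λ i → trans (x≈s i) (sym (y≈s i))) , (λ i → ≡.trans (x≡s i) (≡.sym (y≡s i))))

  apart-sound : ∀ {s t x y} → Denotes s x → Denotes t y → Apart s t → ¬ x ≋ y
  apart-sound {code _ _} {code _ _} (denotes _ x≡s) (denotes _ y≡t) (i , inj₁ images≢) (wrap (_ , tops≡)) =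
    images≢ (≡.trans (≡.sym (x≡s i)) (≡.trans (tops≡ i) (y≡t i)))
  apart-sound {code ws _} {code vs _} {x} (denotes x≈s _) (denotes y≈t _) (i , inj₂ nontrivial) (wrap (bases≈ , _)) =
    provablyNontrivial-sound (reduce q) nontrivial (begin
      eval (reduce q)                                   ≈⟨ reduce-sound q ⟩
      eval q                                            ≈⟨ eval-++ (lookup ws i) _ ⟩
      eval (lookup ws i) ∙ eval (invert (lookup vs i))  ≈⟨ ∙-cong (sym (x≈s i)) (invert-sound (lookup vs i)) ⟩
      base x i ∙ eval (lookup vs i) ⁻¹                  ≈⟨ x≈y⇒x∙y⁻¹≈ε (trans (bases≈ i) (y≈t i)) ⟩
      ε                                                 ∎)
    where q = lookup ws i ++ invert (lookup vs i)

  denotes-tup : ∀ {a₁ a₂ a₃ a₄ a₅ w₁ w₂ w₃ w₄ w₅} π τ → tabulate (π ⟨$⟩ʳ_) ≡ τ →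
    a₁ ≈ eval w₁ → a₂ ≈ eval w₂ → a₃ ≈ eval w₃ → a₄ ≈ eval w₄ → a₅ ≈ eval w₅ →
    Denotes (code (w₁ ∷ w₂ ∷ w₃ ∷ w₄ ∷ w₅ ∷ []) τ) (tup a₁ a₂ a₃ a₄ a₅ ⋊ π)
  denotes-tup π _ ≡.refl e₁ e₂ e₃ e₄ e₅ =
    denotes (λ { zero → e₁ ; (suc zero) → e₂ ; (suc (suc zero)) → e₃
               ; (suc (suc (suc zero))) → e₄ ; (suc (suc (suc (suc zero)))) → e₅ })
            (λ i → ≡.sym (lookup∘tabulate (π ⟨$⟩ʳ_) i))

  private
    ⟦_⟧≈ : ∀ x → ⟦ x ⟧ˡ ≈ eval [ x ]
    ⟦ x ⟧≈ = sym (identityʳ _)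

  denotes-ε : Denotes idᶜ εW
  denotes-ε = denotes (λ { zero → refl ; (suc zero) → refl ; (suc (suc zero)) → refl
                         ; (suc (suc (suc zero))) → refl ; (suc (suc (suc (suc zero)))) → refl })
                      (λ { zero → ≡.refl ; (suc zero) → ≡.refl ; (suc (suc zero)) → ≡.refl
                         ; (suc (suc (suc zero))) → ≡.refl ; (suc (suc (suc (suc zero)))) → ≡.refl })

  denotes-h₁ : Denotes h₁ᶜ h₁
  denotes-h₁ = denotes-tup c123 _ ≡.refl refl refl refl ⟦ l ⟧≈ ⟦ L ⟧≈

  denotes-h₂ : Denotes h₂ᶜ h₂
  denotes-h₂ = denotes-tup t12t45 _ ≡.refl ⟦ m ⟧≈ ⟦ m ⟧≈ ⟦ m ⟧≈ refl refl

  denotes-g : Denotes gᶜ g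
  denotes-g = denotes-tup t14t25 _ ≡.refl refl ⟦ m ⟧≈ refl refl ⟦ m ⟧≈

  h₁∈H : InH h₁
  h₁∈H = gen (fst (unwrap (W.refl {h₁})))

  h₂∈H : InH h₂
  h₂∈H = gen (snd (unwrap (W.refl {h₂})))

  hElts : Vec Elt 6
  hElts = εW ∷ h₁ ∷ h₁ ∙W h₁ ∷ h₂ ∷ h₁ ∙W h₂ ∷ h₂ ∙W h₁ ∷ []

  denotes-hElts : ∀ k → Denotes (lookup hCodes k) (lookup hElts k)
  denotes-hElts = Pointwise.lookup denotations
    where
    denotations : Pointwise Denotes hCodes hElts
    denotations = denotes-ε ∷ denotes-h₁ ∷ denotes-∙ denotes-h₁ denotes-h₁ ∷ denotes-h₂
                ∷ denotes-∙ denotes-h₁ denotes-h₂ ∷ denotes-∙ denotes-h₂ denotes-h₁ ∷ []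

  hElts∈H : ∀ k → InH (lookup hElts k)
  hElts∈H zero                               = one
  hElts∈H (suc zero)                         = h₁∈H
  hElts∈H (suc (suc zero))                   = mul h₁∈H h₁∈H
  hElts∈H (suc (suc (suc zero)))             = h₂∈H
  hElts∈H (suc (suc (suc (suc zero))))       = mul h₁∈H h₂∈H
  hElts∈H (suc (suc (suc (suc (suc zero))))) = mul h₂∈H h₁∈H

  AmongHElts : Elt → Set ℓ
  AmongHElts x = ∃[ k ] x ≋ lookup hElts k

  among-∙ : ∀ {x y} → AmongHElts x → AmongHElts y → AmongHElts (x ∙W y)
  among-∙ (i , x≋hᵢ) (j , y≋hⱼ) = map₂ (λ {k} hᵢhⱼ≡hₖ → W.trans (W.∙-cong x≋hᵢ y≋hⱼ) (denotes-unique
      (≡.subst (λ s → Denotes s (lookup hElts i ∙W lookup hElts j)) hᵢhⱼ≡hₖ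
        (denotes-∙ (denotes-hElts i) (denotes-hElts j)))
      (denotes-hElts k)))
    (hCodes-closed i j)

  among-⁻¹ : ∀ {x} → AmongHElts x → AmongHElts (x ⁻¹W)
  among-⁻¹ (i , x≋hᵢ) = map₂ (λ {k} hᵢhₖ≡id → W.trans (W.⁻¹-cong x≋hᵢ) (W.sym (W-inverseʳ-unique _ _
      (denotes-unique (≡.subst (λ s → Denotes s (lookup hElts i ∙W lookup hElts k)) hᵢhₖ≡id
                        (denotes-∙ (denotes-hElts i) (denotes-hElts k)))
                      denotes-ε))))
    (hCodes-inverse i)

  ∈H⇒among : ∀ {x} → InH x → AmongHElts x
  ∈H⇒among (gen (fst x≈h₁))   = # 1 , wrap x≈h₁
  ∈H⇒among (gen (snd x≈h₂))   = # 3 , wrap x≈h₂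
  ∈H⇒among one                = # 0 , W.refl
  ∈H⇒among (mul x∈H y∈H)      = among-∙ (∈H⇒among x∈H) (∈H⇒among y∈H)
  ∈H⇒among (inv x∈H)          = among-⁻¹ (∈H⇒among x∈H)
  ∈H⇒among (resp x≈y x∈H)     = map₂ (W.trans (W.sym (wrap x≈y))) (∈H⇒among x∈H)

  notInH-sound : ∀ {s x} → Denotes s x → NotInH s → ¬ InH x
  notInH-sound s~x s∉H x∈H =
    let k , x≋hₖ = ∈H⇒among x∈H in apart-sound s~x (denotes-hElts k) (s∉H k) x≋hₖ

  cosetsApart-sound : ∀ {s t x y} → Denotes s x → Denotes t y → CosetsApart s t → ¬ SameCoset x y
  cosetsApart-sound {x = x} {y} s~x t~y s≁t xy⁻¹∈H =
    let k , xy⁻¹≋hₖ = ∈H⇒among xy⁻¹∈H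
    in apart-sound s~x (denotes-∙ (denotes-hElts k) t~y) (s≁t k)
         (W.trans (solve x₀ ((x₀ ⊙ x₁ ⁻) ⊙ x₁) ≡.refl (x ∷ y ∷ [])) (W.∙-congʳ {y} xy⁻¹≋hₖ))

stepCode : Fin 6 → Code → Code
stepCode d t = gᶜ · (lookup hCodes d · t)

-- An injective numbering of image vectors; minimising it over H·u picks a representative of
-- that coset. Being lexicographic, it picks idᶜ for H itself, the start of the search.
imagesKey : Code → ℕ
imagesKey u = foldl′ (λ key i → 5 * key + toℕ i) 0 (images u)

opaque
  canonicalIndex : Code → Fin 6
  canonicalIndex u = argmin (λ k → imagesKey (lookup hCodes k · u)) zero (allFin 6)

successor : Code → Fin 6 → Code
successor t d = lookup hCodes (canonicalIndex (stepCode d t)) · stepCode d t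

opaque
  successors : Code → List Code
  successors t = deduplicate _≟ᶜ_ (map (successor t) (allFin 6))

  successor∈successors : ∀ t d → successor t d ∈ successors t
  successor∈successors t d = ∈-deduplicate⁺ _≟ᶜ_ (∈-map⁺ (successor t) (∈-allFin d))

NoReturn : Code → Set
NoReturn t = ∀ d → NotInH (stepCode d t)

noReturn? : ∀ t → Dec (NoReturn t)
noReturn? t = all? λ d → notInH? (stepCode d t)

module Search = Exploration _≟ᶜ_ successors NoReturn noReturn?

opaque
  unfolding canonicalIndex successors
  search-succeeds : Search.explore 0 8 [] idᶜ ≡ true
  search-succeeds = ≡.refl

module Cycles {c ℓ} (P : Group c ℓ) (μ λ' : Group.Carrier P)
  (perfect : Perfect P) (generated : GeneratedBy P μ λ')
  (μ-order : HasOrder2 P μ) (λ-order : HasOrder3 P λ') where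

  open Wreath P
  open Setup μ λ'
  open WreathGroup P
  private module W = Group wreathGroup
  open import Algebra.Properties.Group wreathGroup using (inverseˡ-unique; inverseʳ-unique; identityˡ-unique)
  open import Relation.Binary.Reasoning.Setoid W.setoid
  open FreeGroupSolver wreathGroup using (var; unit; _⊙_; _⁻; x₀; x₁; x₂; x₃; x₄; solve)
  open Denotation P μ λ' perfect generated μ-order λ-order

  module TenCycle where

    -- vertex (n + 1) = g h vertex n with h = 1, h₁, h₁², h₁, h₁², …; the cycle closes since (h₁² g h₁ g)⁵ = 1.
    turn : ℕ → Fin 6
    turn zero                = # 0
    turn (suc zero)          = # 1
    turn (suc (suc zero))    = # 2
    turn (suc (suc (suc n))) = turn (suc n)

    opaque
      vertex : ℕ → Elt
      vertex zero    = εW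
      vertex (suc n) = (g ∙W lookup hElts (turn n)) ∙W vertex n

      vertex-zero : vertex zero ≡ εW
      vertex-zero = ≡.refl

      vertex-suc : ∀ n → vertex (suc n) ≡ (g ∙W lookup hElts (turn n)) ∙W vertex n
      vertex-suc n = ≡.refl

    vertexCode : ℕ → Code
    vertexCode zero    = idᶜ
    vertexCode (suc n) = (gᶜ · lookup hCodes (turn n)) · vertexCode n

    denotes-vertex : ∀ n → Denotes (vertexCode n) (vertex n)
    denotes-vertex zero    = ≡.subst (Denotes idᶜ) (≡.sym vertex-zero) denotes-ε
    denotes-vertex (suc n) = ≡.subst (Denotes (vertexCode (suc n))) (≡.sym (vertex-suc n))
                               (denotes-∙ (denotes-∙ denotes-g (denotes-hElts (turn n))) (denotes-vertex n))

    g-step-adjacent : ∀ k y → Adj y ((g ∙W lookup hElts k) ∙W y)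
    g-step-adjacent k y = εW , lookup hElts k , one , hElts∈H k ,
      unwrap (solve (((x₀ ⊙ x₁) ⊙ x₂) ⊙ x₂ ⁻) ((unit ⊙ x₀) ⊙ x₁) ≡.refl (g ∷ lookup hElts k ∷ y ∷ []))

    v : Fin 10 → Elt
    v i = vertex (toℕ i)

    opaque
      unfolding vertex
      v∈X : ∀ i → InX (v i)
      v∈X = toWitness {a? = all? λ i → inversions (top (v i)) % 2 ≟ⁿ 0} _

    vertexCodes-apart : ∀ (i j : Fin 10) → i ≡ j ⊎ CosetsApart (vertexCode (toℕ i)) (vertexCode (toℕ j))
    vertexCodes-apart =
      toWitness {a? = all? λ i → all? λ j → i ≟ᶠ j ⊎-dec cosetsApart? (vertexCode (toℕ i)) (vertexCode (toℕ j))} _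

    v-distinct : ∀ i j → SameCoset (v i) (v j) → i ≡ j
    v-distinct i j same =
      fromInj₁ (λ apart → ⊥-elim (cosetsApart-sound (denotes-vertex (toℕ i)) (denotes-vertex (toℕ j)) apart same))
               (vertexCodes-apart i j)

    v-adjacent : ∀ (i : Fin 9) → Adj (v (inject₁ i)) (v (suc i))
    v-adjacent i = ≡.subst₂ (λ j y → Adj (vertex j) y) (≡.sym (toℕ-inject₁ i)) (≡.sym (vertex-suc (toℕ i)))
                            (g-step-adjacent (turn (toℕ i)) (vertex (toℕ i)))

    v-closing : Adj (v (fromℕ 9)) (v zero)
    v-closing = lookup hElts (# 2) , lookup hElts (# 1) , hElts∈H (# 2) , hElts∈H (# 1) , unwrap (begin
      vertex 0 ∙W (vertex 9 ⁻¹W)  ≈⟨ W.∙-congʳ {vertex 9 ⁻¹W} (W.reflexive vertex-zero) ⟩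
      εW ∙W (vertex 9 ⁻¹W)        ≈⟨ W.identityˡ (vertex 9 ⁻¹W) ⟩
      vertex 9 ⁻¹W                ≈⟨ inverseˡ-unique h₁²gh₁ (vertex 9) (denotes-unique closes denotes-ε) ⟨
      h₁²gh₁                      ∎)
      where
      h₁²gh₁ = (lookup hElts (# 2) ∙W g) ∙W lookup hElts (# 1)
      closes : Denotes idᶜ (h₁²gh₁ ∙W vertex 9)
      closes = denotes-∙ {x = h₁²gh₁} {y = vertex 9}
                 (denotes-∙ (denotes-∙ (denotes-hElts (# 2)) denotes-g) (denotes-hElts (# 1))) (denotes-vertex 9)

    cycle : IsCycle 9 v
    cycle = v∈X , v-distinct , v-adjacent , v-closing

  module NoShortCycle (k : ℕ) (2≤k : 2 ≤ k) (v : Fin (suc k) → Elt) (cycle : IsCycle k v) where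

    private
      index : ℕ → Fin (suc k)
      index n with n ≤? k
      ... | yes n≤k = fromℕ< (s≤s n≤k)
      ... | no  _   = zero

      toℕ-index : ∀ {n} → n ≤ k → toℕ (index n) ≡ n
      toℕ-index {n} n≤k with n ≤? k
      ... | yes _   = toℕ-fromℕ< (s≤s n≤k)
      ... | no  n≰k = ⊥-elim (n≰k n≤k)

    vertex : ℕ → Elt
    vertex n = v (index n)

    vertex-distinct : ∀ {i j} → i ≤ k → j ≤ k → SameCoset (vertex i) (vertex j) → i ≡ j
    vertex-distinct {i} {j} i≤k j≤k same =
      ≡.trans (≡.sym (toℕ-index i≤k))
              (≡.trans (≡.cong toℕ (proj₁ (proj₂ cycle) (index i) (index j) same)) (toℕ-index j≤k))

    vertex-adjacent : ∀ {n} → n < k → Adj (vertex n) (vertex (suc n))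
    vertex-adjacent {n} n<k =
      ≡.subst₂ (λ i j → Adj (v i) (v j)) (toℕ-injective inject₁≡) (toℕ-injective suc≡) (proj₁ (proj₂ (proj₂ cycle)) (fromℕ< n<k))
      where
      inject₁≡ : toℕ (inject₁ (fromℕ< n<k)) ≡ toℕ (index n)
      inject₁≡ = ≡.trans (toℕ-inject₁ (fromℕ< n<k)) (≡.trans (toℕ-fromℕ< n<k) (≡.sym (toℕ-index (<⇒≤ n<k))))
      suc≡ : suc (toℕ (fromℕ< n<k)) ≡ toℕ (index (suc n))
      suc≡ = ≡.trans (≡.cong suc (toℕ-fromℕ< n<k)) (≡.sym (toℕ-index n<k))

    vertex-closing : Adj (vertex k) (vertex 0)
    vertex-closing = ≡.subst₂ (λ i j → Adj (v i) (v j)) (toℕ-injective fromℕ≡) ≡.refl (proj₂ (proj₂ (proj₂ cycle)))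
      where
      fromℕ≡ : toℕ (fromℕ k) ≡ toℕ (index k)
      fromℕ≡ = ≡.trans (toℕ-fromℕ k) (≡.sym (toℕ-index ≤-refl))

    -- vertex n lies in the right coset H y (vertex 0) of an element y with code t.
    record Reached (n : ℕ) (t : Code) : Set (c ⊔ ℓ) where
      field
        elt        : Elt
        denotation : Denotes t elt
        coset      : Elt
        coset∈H    : InH coset
        vertex≋    : vertex n ≋ coset ∙W (elt ∙W vertex 0)

    reached-start : Reached 0 idᶜ
    reached-start = record
      { elt = εW ; denotation = denotes-ε ; coset = εW ; coset∈H = one
      ; vertex≋ = solve x₀ (unit ⊙ (unit ⊙ x₀)) ≡.refl (vertex 0 ∷ []) }

    private
      edge : ∀ {n t} (r : Reached n t) {x a b} → InH b → (x ∙W (vertex n ⁻¹W)) ≈W ((a ∙W g) ∙W b) →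
             ∃[ d ] x ≋ (a ∙W g) ∙W (lookup hElts d ∙W (Reached.elt r ∙W vertex 0))
      edge {n} r {x} {a} {b} b∈H x∼vertex = map₂ (λ {d} b∙coset≋hd → begin
          x                                                ≈⟨ solve x₀ ((x₀ ⊙ x₁ ⁻) ⊙ x₁) ≡.refl (x ∷ vertex n ∷ []) ⟩
          (x ∙W (vertex n ⁻¹W)) ∙W vertex n                ≈⟨ W.∙-cong {x ∙W (vertex n ⁻¹W)} {(a ∙W g) ∙W b}
                                                                        (wrap x∼vertex) vertex≋ ⟩
          ((a ∙W g) ∙W b) ∙W (coset ∙W (elt ∙W vertex 0))
            ≈⟨ solve (((x₀ ⊙ x₁) ⊙ x₂) ⊙ (x₃ ⊙ x₄)) ((x₀ ⊙ x₁) ⊙ ((x₂ ⊙ x₃) ⊙ x₄)) ≡.refl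
                     (a ∷ g ∷ b ∷ coset ∷ elt ∙W vertex 0 ∷ []) ⟩
          (a ∙W g) ∙W ((b ∙W coset) ∙W (elt ∙W vertex 0))  ≈⟨ W.∙-congˡ {a ∙W g} (W.∙-congʳ {elt ∙W vertex 0} b∙coset≋hd) ⟩
          (a ∙W g) ∙W (lookup hElts d ∙W (elt ∙W vertex 0)) ∎)
        (∈H⇒among (mul b∈H coset∈H))
        where open Reached r

      successor-reached : ∀ {n t} (r : Reached n t) {a} → InH a → ∀ d →
        vertex (suc n) ≋ (a ∙W g) ∙W (lookup hElts d ∙W (Reached.elt r ∙W vertex 0)) →
        ∃[ t′ ] t′ ∈ successors t × Reached (suc n) t′
      successor-reached {n} {t} r {a} a∈H d next≋ = successor t d , successor∈successors t d , record
        { elt        = hⱼ ∙W (g ∙W (hd ∙W elt))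
        ; denotation = denotes-∙ (denotes-hElts j) (denotes-∙ denotes-g (denotes-∙ (denotes-hElts d) denotation))
        ; coset      = a ∙W (hⱼ ⁻¹W)
        ; coset∈H    = mul a∈H (inv (hElts∈H j))
        ; vertex≋    = W.trans next≋
            (solve ((x₀ ⊙ x₁) ⊙ (x₂ ⊙ (x₃ ⊙ x₄))) ((x₀ ⊙ var (# 5) ⁻) ⊙ ((var (# 5) ⊙ (x₁ ⊙ (x₂ ⊙ x₃))) ⊙ x₄)) ≡.refl
                   (a ∷ g ∷ hd ∷ elt ∷ vertex 0 ∷ hⱼ ∷ []))
        }
        where
        open Reached r
        hd = lookup hElts d
        j  = canonicalIndex (stepCode d t)
        hⱼ = lookup hElts j

      returning⇒stepCode∈H : ∀ {t} (r : Reached k t) {a} → InH a → ∀ d →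
        vertex 0 ≋ (a ∙W g) ∙W (lookup hElts d ∙W (Reached.elt r ∙W vertex 0)) →
        InH (g ∙W (lookup hElts d ∙W Reached.elt r))
      returning⇒stepCode∈H r {a} a∈H d v₀≋ =
        resp {x = a ⁻¹W} {y = y} (unwrap (W.sym (inverseʳ-unique a y (identityˡ-unique _ (vertex 0) returns)))) (inv a∈H)
        where
        open Reached r
        y = g ∙W (lookup hElts d ∙W elt)
        returns : ((a ∙W y) ∙W vertex 0) ≋ vertex 0
        returns = W.sym (W.trans v₀≋
          (solve ((x₀ ⊙ x₁) ⊙ (x₂ ⊙ (x₃ ⊙ x₄))) ((x₀ ⊙ (x₁ ⊙ (x₂ ⊙ x₃))) ⊙ x₄) ≡.refl
                 (a ∷ g ∷ lookup hElts d ∷ elt ∷ vertex 0 ∷ [])))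

    reached-next : ∀ {n t} → n < k → Reached n t → ∃[ t′ ] t′ ∈ successors t × Reached (suc n) t′
    reached-next {n} n<k r =
      let a , b , a∈H , b∈H , step = vertex-adjacent n<k
          d , next≋ = edge r {vertex (suc n)} {a} {b} b∈H step
      in  successor-reached r a∈H d next≋

    reached-injective : ∀ {i j t} → i ≤ k → j ≤ k → Reached i t → Reached j t → i ≡ j
    reached-injective {i} {j} i≤k j≤k r r′ = vertex-distinct i≤k j≤k
      (resp {x = coset r ∙W (coset r′ ⁻¹W)} {y = vertex i ∙W (vertex j ⁻¹W)} (unwrap (W.sym quotient≋))
            (mul (coset∈H r) (inv (coset∈H r′))))
      where
      open Reached
      y′≋y : elt r′ ≋ elt r
      y′≋y = denotes-unique (denotation r′) (denotation r)
      quotient≋ : (vertex i ∙W (vertex j ⁻¹W)) ≋ (coset r ∙W (coset r′ ⁻¹W))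
      quotient≋ = begin
        vertex i ∙W (vertex j ⁻¹W)
          ≈⟨ W.∙-cong {vertex i} {coset r ∙W (elt r ∙W vertex 0)} (vertex≋ r)
               (W.⁻¹-cong {vertex j} {coset r′ ∙W (elt r ∙W vertex 0)}
                 (W.trans (vertex≋ r′) (W.∙-congˡ {coset r′} (W.∙-congʳ {vertex 0} y′≋y)))) ⟩
        (coset r ∙W (elt r ∙W vertex 0)) ∙W ((coset r′ ∙W (elt r ∙W vertex 0)) ⁻¹W)
          ≈⟨ solve ((x₀ ⊙ x₁) ⊙ (x₂ ⊙ x₁) ⁻) (x₀ ⊙ x₂ ⁻) ≡.refl (coset r ∷ elt r ∙W vertex 0 ∷ coset r′ ∷ []) ⟩
        coset r ∙W (coset r′ ⁻¹W) ∎

    reached-unblocked : ∀ {t} → Reached k t → ¬ NoReturn t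
    reached-unblocked r noReturn =
      let a , b , a∈H , b∈H , closing = vertex-closing
          d , v₀≋ = edge r {vertex 0} {a} {b} b∈H closing
      in  notInH-sound (denotes-∙ denotes-g (denotes-∙ (denotes-hElts d) (Reached.denotation r))) (noReturn d)
                       (returning⇒stepCode∈H r a∈H d v₀≋)

  no-short-cycle : ∀ k → 2 ≤ k → k < 9 → ∀ v → ¬ IsCycle k v
  no-short-cycle k 2≤k k<9 v cycle =
    Search.explore-sound k 2≤k Reached idᶜ reached-start reached-next reached-injective reached-unblocked
      8 (≤-pred k<9) (Equivalence.from T-≡ search-succeeds)
    where open NoShortCycle k 2≤k v cycle

mainTheorem10 : ∀ {c ℓ} (P : Group c ℓ) (μ λ' : Group.Carrier P) →
    Finite P → Perfect P → GeneratedBy P μ λ' →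
    HasOrder2 P μ → HasOrder3 P λ' →
    Wreath.Setup.HasGirth P μ λ' 10
mainTheorem10 P μ λ' _ perfect generated μ-order λ-order =
  (TenCycle.v , TenCycle.cycle) , no-short-cycle
  where open Cycles P μ λ' perfect generated μ-order λ-order
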